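{- Let $a,b,c,d$ be real numbers with $a+b=c+d$, let $n\ge 1$, and let $k_1,\dots,k_n$ be real numbers. Define finite sequences $x^{(m)}=(x^{(m)}_1,\dots,x^{(m)}_{2^m})$ and $y^{(m)}=(y^{(m)}_1,\dots,y^{(m)}_{2^m})$ for $1\le m\le n$ recursively by $x^{(1)}=(a+k_1,\;b+k_1)$, $y^{(1)}=(c+k_1,\;d+k_1)$, and for $2\le m\le n$ and $1\le j\le 2^{m-1}$: $x^{(m)}_j=x^{(m-1)}_j$, $x^{(m)}_{2^{m-1}+j}=y^{(m-1)}_j+k_m$, $y^{(m)}_j=y^{(m-1)}_j$, $y^{(m)}_{2^{m-1}+j}=x^{(m-1)}_j+k_m$. Write $x_j=x^{(n)}_j$, $y_j=y^{(n)}_j$. Then for all integers $i,p$ with $1\le i\le n$ and $0\le p\le 2^{n-i}-1$, $$\sum_{j=p2^i+1}^{(p+1)2^i}x_j^i=\sum_{j=p2^i+1}^{(p+1)2^i}y_j^i .$$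
   Context: All numbers are real. -}

module Defs where

open import Level using (Level)
open import Data.Nat as ℕ using (ℕ; zero; suc; _∸_; _≤ᵇ_)
open import Data.Bool using (if_then_else_)
open import Data.Product using (_×_; _,_; proj₁; proj₂)
open import Algebra.Bundles using (CommutativeRing)

-- Everything is parametrised by a commutative ring R (the paper uses ℝ).
-- Sequences are represented as functions ℕ → Carrier with 1-based indices;
-- only the indices 1 … 2^m are meaningful (others are unused junk).
-- The parameters k₁,…,kₙ are given as k : ℕ → Carrier, using k 1 … k n.
module _ {ℓ₁ ℓ₂ : Level} (R : CommutativeRing ℓ₁ ℓ₂) where
  open CommutativeRing R

  pow : Carrier → ℕ → Carrier
  pow x zero    = 1#
  pow x (suc i) = x * pow x i

  sumFrom : (ℕ → Carrier) → ℕ → ℕ → Carrier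
  sumFrom f s zero    = 0#
  sumFrom f s (suc l) = f s + sumFrom f (suc s) l

  -- the pair (x^(m), y^(m)); level 0 is an unused dummy
  seqs : (a b c d : Carrier) (k : ℕ → Carrier) → ℕ → (ℕ → Carrier) × (ℕ → Carrier)
  seqs a b c d k zero = (λ _ → 0#) , (λ _ → 0#)
  seqs a b c d k (suc zero) = xs , ys
    where
    xs : ℕ → Carrier
    xs 1 = a + k 1
    xs 2 = b + k 1
    xs _ = 0#
    ys : ℕ → Carrier
    ys 1 = c + k 1
    ys 2 = d + k 1
    ys _ = 0#
  seqs a b c d k (suc (suc m)) = step (suc (suc m)) (seqs a b c d k (suc m))
    where
    step : ℕ → (ℕ → Carrier) × (ℕ → Carrier) → (ℕ → Carrier) × (ℕ → Carrier)
    step m' (xp , yp) =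
        (λ j → if j ≤ᵇ h then xp j else yp (j ∸ h) + k m')
      , (λ j → if j ≤ᵇ h then yp j else xp (j ∸ h) + k m')
      where
      h = 2 ℕ.^ (m' ∸ 1)

  xSeq : (a b c d : Carrier) (k : ℕ → Carrier) → ℕ → ℕ → Carrier
  xSeq a b c d k m = proj₁ (seqs a b c d k m)

  ySeq : (a b c d : Carrier) (k : ℕ → Carrier) → ℕ → ℕ → Carrier
  ySeq a b c d k m = proj₂ (seqs a b c d k m)

{-# OPTIONS --safe #-}
-- Write Sₜ(f) for the t-th power sum of a block of values.  If Sₜ(f) = Sₜ(g) for all
-- t ≤ e, the same holds for the translates f + K, g + K, and moreover the sequences
-- f ++ (g + K) and g ++ (f + K) have equal power sums up to degree e + 1.  The level-m
-- pair is built from the level-(m-1) pair by exactly this doubling, so by induction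
-- x⁽ᵐ⁾ and y⁽ᵐ⁾ have equal power sums up to degree m.  The blocks of length 2ⁱ of the
-- level-n pair are translates of the level-i pair, possibly with x and y swapped.
module Submission where

open import Defs
open import Level using (Level)
open import Algebra.Bundles using (CommutativeRing)
import Algebra.Properties.CommutativeSemigroup as CommutativeSemigroupProperties
open import Data.Bool using (true; false; if_then_else_)
open import Data.Empty using (⊥-elim)
open import Data.Nat as ℕ using (ℕ; zero; suc; _≤_; _<_; _∸_; _≤ᵇ_; z≤n; s≤s; z<s)
import Data.Nat.Properties as ℕₚ
open import Data.Product using (∃-syntax; _×_; _,_)
open import Data.Sum using (_⊎_; inj₁; inj₂; [_,_]′)
open import Function using (_∘′_)
open import Relation.Binary.PropositionalEquality as ≡ using (_≡_; cong; subst)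
import Relation.Binary.Reasoning.Setoid as SetoidReasoning
open import Relation.Nullary.Decidable using (yes; no)
open import Relation.Nullary.Reflects using (ofʸ; ofⁿ)

if-≤ᵇ-lower : ∀ {a} {A : Set a} {j h : ℕ} {u v : A} → j ≤ h → (if j ≤ᵇ h then u else v) ≡ u
if-≤ᵇ-lower {j = j} {h} j≤h with j ≤ᵇ h | ℕₚ.≤ᵇ-reflects-≤ j h
... | true  | _      = ≡.refl
... | false | ofⁿ j≰h = ⊥-elim (j≰h j≤h)

if-≤ᵇ-upper : ∀ {a} {A : Set a} (j h : ℕ) {u : A} (v : ℕ → A) →
              (if suc j ℕ.+ h ≤ᵇ h then u else v (suc j ℕ.+ h ∸ h)) ≡ v (suc j)
if-≤ᵇ-upper j h v with suc j ℕ.+ h ≤ᵇ h | ℕₚ.≤ᵇ-reflects-≤ (suc j ℕ.+ h) h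
... | true  | ofʸ j+h≤h = ⊥-elim (ℕₚ.<⇒≱ (ℕₚ.m<n+m h z<s) j+h≤h)
... | false | _         = cong v (ℕₚ.m+n∸n≡m (suc j) h)

<-double-split : ∀ h {p} → p < 2 ℕ.* h → p < h ⊎ ∃[ q ] (q < h × p ≡ h ℕ.+ q)
<-double-split h {p} p<2h with p ℕ.<? h
... | yes p<h = inj₁ p<h
... | no p≮h  = inj₂ (p ∸ h , q<h , ≡.sym (ℕₚ.m+[n∸m]≡n h≤p))
  where
  h≤p = ℕₚ.≮⇒≥ p≮h
  q<h : p ∸ h < h
  q<h = ℕₚ.+-cancelˡ-< h (p ∸ h) h
          (subst (_< h ℕ.+ h) (≡.sym (ℕₚ.m+[n∸m]≡n h≤p)) (subst (p <_) (cong (h ℕ.+_) (ℕₚ.+-identityʳ h)) p<2h))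

≤∸1⇒< : ∀ {p n} → 0 < n → p ≤ n ∸ 1 → p < n
≤∸1⇒< {n = suc _} _ p≤n∸1 = s≤s p≤n∸1

lower-block-end-≤ : ∀ m j {p} → p < 2 ℕ.^ m → suc (p ℕ.* 2 ℕ.^ j) ℕ.+ 2 ℕ.^ j ≤ suc (2 ℕ.^ (m ℕ.+ j))
lower-block-end-≤ m j {p} p<2ᵐ = s≤s (begin
  p ℕ.* 2 ℕ.^ j ℕ.+ 2 ℕ.^ j   ≡⟨ ℕₚ.+-comm (p ℕ.* 2 ℕ.^ j) _ ⟩
  suc p ℕ.* 2 ℕ.^ j           ≤⟨ ℕₚ.*-monoˡ-≤ (2 ℕ.^ j) p<2ᵐ ⟩
  2 ℕ.^ m ℕ.* 2 ℕ.^ j         ≡⟨ ℕₚ.^-distribˡ-+-* 2 m j ⟨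
  2 ℕ.^ (m ℕ.+ j)             ∎)
  where open ℕₚ.≤-Reasoning

upper-block-start-≡ : ∀ m j q → suc ((2 ℕ.^ m ℕ.+ q) ℕ.* 2 ℕ.^ j) ≡ suc (q ℕ.* 2 ℕ.^ j) ℕ.+ 2 ℕ.^ (m ℕ.+ j)
upper-block-start-≡ m j q = cong suc (begin
  (2 ℕ.^ m ℕ.+ q) ℕ.* 2 ℕ.^ j              ≡⟨ ℕₚ.*-distribʳ-+ (2 ℕ.^ j) (2 ℕ.^ m) q ⟩
  2 ℕ.^ m ℕ.* 2 ℕ.^ j ℕ.+ q ℕ.* 2 ℕ.^ j    ≡⟨ ℕₚ.+-comm (2 ℕ.^ m ℕ.* 2 ℕ.^ j) _ ⟩
  q ℕ.* 2 ℕ.^ j ℕ.+ 2 ℕ.^ m ℕ.* 2 ℕ.^ j    ≡⟨ cong (q ℕ.* 2 ℕ.^ j ℕ.+_) (ℕₚ.^-distribˡ-+-* 2 m j) ⟨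
  q ℕ.* 2 ℕ.^ j ℕ.+ 2 ℕ.^ (m ℕ.+ j)        ∎)
  where open ≡.≡-Reasoning

module _ {ℓ₁ ℓ₂ : Level} (R : CommutativeRing ℓ₁ ℓ₂) where
  open CommutativeRing R
  open SetoidReasoning setoid
  open CommutativeSemigroupProperties +-commutativeSemigroup using (interchange)
  open CommutativeSemigroupProperties *-commutativeSemigroup using (x∙yz≈y∙xz)

  private
    ∑ : (ℕ → Carrier) → ℕ → ℕ → Carrier
    ∑ = sumFrom R

    _^_ : Carrier → ℕ → Carrier
    x ^ t = pow R x t

  sumFrom-cong : ∀ {f g : ℕ → Carrier} s l → (∀ j → s ≤ j → j < s ℕ.+ l → f j ≈ g j) →
                 ∑ f s l ≈ ∑ g s l
  sumFrom-cong s zero    f≈g = refl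
  sumFrom-cong s (suc l) f≈g =
    +-cong (f≈g s ℕₚ.≤-refl (ℕₚ.m<m+n s z<s))
           (sumFrom-cong (suc s) l λ j s<j j<s+l →
              f≈g j (ℕₚ.<⇒≤ s<j) (subst (j <_) (≡.sym (ℕₚ.+-suc s l)) j<s+l))

  sumFrom-+ : ∀ (f g : ℕ → Carrier) s l → ∑ (λ j → f j + g j) s l ≈ ∑ f s l + ∑ g s l
  sumFrom-+ f g s zero    = sym (+-identityʳ 0#)
  sumFrom-+ f g s (suc l) = trans (+-congˡ (sumFrom-+ f g (suc s) l)) (interchange _ _ _ _)

  sumFrom-*ˡ : ∀ K (f : ℕ → Carrier) s l → ∑ (λ j → K * f j) s l ≈ K * ∑ f s l
  sumFrom-*ˡ K f s zero    = sym (zeroʳ K)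
  sumFrom-*ˡ K f s (suc l) = trans (+-congˡ (sumFrom-*ˡ K f (suc s) l)) (sym (distribˡ K _ _))

  sumFrom-++ : ∀ (f : ℕ → Carrier) s l₁ l₂ → ∑ f s (l₁ ℕ.+ l₂) ≈ ∑ f s l₁ + ∑ f (s ℕ.+ l₁) l₂
  sumFrom-++ f s zero     l₂ rewrite ℕₚ.+-identityʳ s = sym (+-identityˡ _)
  sumFrom-++ f s (suc l₁) l₂ rewrite ℕₚ.+-suc s l₁ =
    trans (+-congˡ (sumFrom-++ f (suc s) l₁ l₂)) (sym (+-assoc _ _ _))

  sumFrom-halves : ∀ (f : ℕ → Carrier) s n →
                   ∑ f s (2 ℕ.^ suc n) ≈ ∑ f s (2 ℕ.^ n) + ∑ f (s ℕ.+ 2 ℕ.^ n) (2 ℕ.^ n)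
  sumFrom-halves f s n = begin
    ∑ f s (2 ℕ.^ n ℕ.+ (2 ℕ.^ n ℕ.+ 0))                   ≡⟨ cong (∑ f s ∘′ (2 ℕ.^ n ℕ.+_)) (ℕₚ.+-identityʳ _) ⟩
    ∑ f s (2 ℕ.^ n ℕ.+ 2 ℕ.^ n)                            ≈⟨ sumFrom-++ f s (2 ℕ.^ n) (2 ℕ.^ n) ⟩
    ∑ f s (2 ℕ.^ n) + ∑ f (s ℕ.+ 2 ℕ.^ n) (2 ℕ.^ n)        ∎

  sumFrom-translate : ∀ (f : ℕ → Carrier) s h l → ∑ f (s ℕ.+ h) l ≡ ∑ (λ j → f (j ℕ.+ h)) s l
  sumFrom-translate f s h zero    = ≡.refl
  sumFrom-translate f s h (suc l) = cong (f (s ℕ.+ h) +_) (sumFrom-translate f (suc s) h l)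

  shift : Carrier → (ℕ → Carrier) → ℕ → Carrier
  shift K f j = f j + K

  powerSum : (ℕ → Carrier) → ℕ → ℕ → ℕ → Carrier
  powerSum f t s l = ∑ (λ j → f j ^ t) s l

  record EqualPowerSums (e s l : ℕ) (f g : ℕ → Carrier) : Set ℓ₂ where
    constructor equalPowerSums
    field
      powerSum-≈ : ∀ t → t ≤ e → powerSum f t s l ≈ powerSum g t s l

  open EqualPowerSums

  EqualPowerSums-sym : ∀ {e s l f g} → EqualPowerSums e s l f g → EqualPowerSums e s l g f
  EqualPowerSums-sym f~g = equalPowerSums λ t t≤e → sym (powerSum-≈ f~g t t≤e)

  powerSum-agree-below : ∀ {F G : ℕ → Carrier} {h} → (∀ {j} → j ≤ h → F j ≡ G j) →
                   ∀ t s l → s ℕ.+ l ≤ suc h → powerSum F t s l ≈ powerSum G t s l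
  powerSum-agree-below F≡G t s l s+l≤1+h =
    sumFrom-cong s l λ j _ j<s+l → reflexive (cong (_^ t) (F≡G (ℕ.s≤s⁻¹ (ℕₚ.<-≤-trans j<s+l s+l≤1+h))))

  powerSum-translate : ∀ {F G : ℕ → Carrier} h → (∀ j → F (suc j ℕ.+ h) ≡ G (suc j)) →
                   ∀ t s l → powerSum F t (suc s ℕ.+ h) l ≈ powerSum G t (suc s) l
  powerSum-translate {F} {G} h F≡G t s l = begin
    powerSum F t (suc s ℕ.+ h) l          ≡⟨ sumFrom-translate (λ j → F j ^ t) (suc s) h l ⟩
    ∑ (λ j → F (j ℕ.+ h) ^ t) (suc s) l   ≈⟨ sumFrom-cong (suc s) l F≈G ⟩
    powerSum G t (suc s) l                ∎
    where
    F≈G : ∀ j → suc s ≤ j → j < suc s ℕ.+ l → F (j ℕ.+ h) ^ t ≈ G j ^ t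
    F≈G (suc j) _ _ = reflexive (cong (_^ t) (F≡G j))

  -- Trading one factor fⱼ + K for fⱼ (mixed-suc) expresses translated power sums through
  -- untranslated ones without binomial coefficients.
  module MixedSums (K : Carrier) (s l : ℕ) where
    open CommutativeSemigroupProperties +-commutativeSemigroup using (xy∙z≈xz∙y)

    mixed : (ℕ → Carrier) → ℕ → ℕ → Carrier
    mixed f u r = ∑ (λ j → f j ^ u * (f j + K) ^ r) s l

    mixed-zeroʳ : ∀ f u → mixed f u 0 ≈ powerSum f u s l
    mixed-zeroʳ f u = sumFrom-cong s l λ j _ _ → *-identityʳ _

    mixed-zeroˡ : ∀ f r → mixed f 0 r ≈ powerSum (shift K f) r s l
    mixed-zeroˡ f r = sumFrom-cong s l λ j _ _ → *-identityˡ _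

    mixed-suc : ∀ f u r → mixed f u (suc r) ≈ mixed f (suc u) r + K * mixed f u r
    mixed-suc f u r = begin
      ∑ (λ j → f j ^ u * ((f j + K) * (f j + K) ^ r)) s l
        ≈⟨ sumFrom-cong s l (λ j _ _ → expand (f j ^ u) (f j) ((f j + K) ^ r)) ⟩
      ∑ (λ j → (f j * f j ^ u) * (f j + K) ^ r + K * (f j ^ u * (f j + K) ^ r)) s l
        ≈⟨ sumFrom-+ _ _ s l ⟩
      mixed f (suc u) r + ∑ (λ j → K * (f j ^ u * (f j + K) ^ r)) s l
        ≈⟨ +-congˡ (sumFrom-*ˡ K _ s l) ⟩
      mixed f (suc u) r + K * mixed f u r
        ∎
      where
      expand : ∀ v x w → v * ((x + K) * w) ≈ (x * v) * w + K * (v * w)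
      expand v x w = begin
        v * ((x + K) * w)          ≈⟨ *-congˡ (distribʳ w x K) ⟩
        v * (x * w + K * w)        ≈⟨ distribˡ v _ _ ⟩
        v * (x * w) + v * (K * w)  ≈⟨ +-cong (x∙yz≈y∙xz v x w) (x∙yz≈y∙xz v K w) ⟩
        x * (v * w) + K * (v * w)  ≈⟨ +-congʳ (sym (*-assoc x v w)) ⟩
        (x * v) * w + K * (v * w)  ∎

    module _ {e f g} (f~g : EqualPowerSums e s l f g) where

      mixed-equal : ∀ r u → u ℕ.+ r ≤ e → mixed f u r ≈ mixed g u r
      mixed-equal zero u u+0≤e = begin
        mixed f u 0        ≈⟨ mixed-zeroʳ f u ⟩
        powerSum f u s l   ≈⟨ powerSum-≈ f~g u (subst (_≤ e) (ℕₚ.+-identityʳ u) u+0≤e) ⟩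
        powerSum g u s l   ≈⟨ mixed-zeroʳ g u ⟨
        mixed g u 0        ∎
      mixed-equal (suc r) u u+r<e = begin
        mixed f u (suc r)                     ≈⟨ mixed-suc f u r ⟩
        mixed f (suc u) r + K * mixed f u r   ≈⟨ +-cong (mixed-equal r (suc u) (subst (_≤ e) (ℕₚ.+-suc u r) u+r<e))
                                                         (*-congˡ (mixed-equal r u (ℕₚ.<⇒≤ (subst (_≤ e) (ℕₚ.+-suc u r) u+r<e)))) ⟩
        mixed g (suc u) r + K * mixed g u r   ≈⟨ mixed-suc g u r ⟨
        mixed g u (suc r)                     ∎

      mixed-top : ∀ r u → u ℕ.+ r ≤ suc e →
                  mixed f u r + powerSum g (u ℕ.+ r) s l ≈ mixed g u r + powerSum f (u ℕ.+ r) s l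
      mixed-top zero u _ rewrite ℕₚ.+-identityʳ u = begin
        mixed f u 0 + powerSum g u s l        ≈⟨ +-congʳ (mixed-zeroʳ f u) ⟩
        powerSum f u s l + powerSum g u s l   ≈⟨ +-comm _ _ ⟩
        powerSum g u s l + powerSum f u s l   ≈⟨ +-congʳ (mixed-zeroʳ g u) ⟨
        mixed g u 0 + powerSum f u s l        ∎
      mixed-top (suc r) u u+r≤e rewrite ℕₚ.+-suc u r = begin
        mixed f u (suc r) + powerSum g (suc u ℕ.+ r) s l
          ≈⟨ +-congʳ (mixed-suc f u r) ⟩
        (mixed f (suc u) r + K * mixed f u r) + powerSum g (suc u ℕ.+ r) s l
          ≈⟨ xy∙z≈xz∙y _ _ _ ⟩
        (mixed f (suc u) r + powerSum g (suc u ℕ.+ r) s l) + K * mixed f u r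
          ≈⟨ +-cong (mixed-top r (suc u) u+r≤e) (*-congˡ (mixed-equal r u (ℕₚ.≤-pred u+r≤e))) ⟩
        (mixed g (suc u) r + powerSum f (suc u ℕ.+ r) s l) + K * mixed g u r
          ≈⟨ xy∙z≈xz∙y _ _ _ ⟩
        (mixed g (suc u) r + K * mixed g u r) + powerSum f (suc u ℕ.+ r) s l
          ≈⟨ +-congʳ (mixed-suc g u r) ⟨
        mixed g u (suc r) + powerSum f (suc u ℕ.+ r) s l
          ∎

  EqualPowerSums-shift : ∀ {e s l f g} → EqualPowerSums e s l f g →
                         ∀ K → EqualPowerSums e s l (shift K f) (shift K g)
  EqualPowerSums-shift {s = s} {l} {f} {g} f~g K = equalPowerSums λ t t≤e → begin
    powerSum (shift K f) t s l   ≈⟨ mixed-zeroˡ f t ⟨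
    mixed f 0 t                  ≈⟨ mixed-equal f~g t 0 t≤e ⟩
    mixed g 0 t                  ≈⟨ mixed-zeroˡ g t ⟩
    powerSum (shift K g) t s l   ∎
    where open MixedSums K s l

  prouhet-doubling : ∀ {e s l f g} → EqualPowerSums e s l f g → ∀ K t → t ≤ suc e →
                     powerSum f t s l + powerSum (shift K g) t s l
                       ≈ powerSum g t s l + powerSum (shift K f) t s l
  prouhet-doubling {s = s} {l} {f} {g} f~g K t t≤1+e = begin
    powerSum f t s l + powerSum (shift K g) t s l   ≈⟨ +-comm _ _ ⟩
    powerSum (shift K g) t s l + powerSum f t s l   ≈⟨ +-congʳ (mixed-zeroˡ g t) ⟨
    mixed g 0 t + powerSum f t s l                  ≈⟨ mixed-top (EqualPowerSums-sym f~g) t 0 t≤1+e ⟩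
    mixed f 0 t + powerSum g t s l                  ≈⟨ +-congʳ (mixed-zeroˡ f t) ⟩
    powerSum (shift K f) t s l + powerSum g t s l   ≈⟨ +-comm _ _ ⟩
    powerSum g t s l + powerSum (shift K f) t s l   ∎
    where open MixedSums K s l

  module _ (a b c d : Carrier) (k : ℕ → Carrier) where
    private
      X Y : ℕ → ℕ → Carrier
      X = xSeq R a b c d k
      Y = ySeq R a b c d k

    xSeq-lower : ∀ {n} → 1 ≤ n → ∀ {j} → j ≤ 2 ℕ.^ n → X (suc n) j ≡ X n j
    xSeq-lower {suc _} _ = if-≤ᵇ-lower

    ySeq-lower : ∀ {n} → 1 ≤ n → ∀ {j} → j ≤ 2 ℕ.^ n → Y (suc n) j ≡ Y n j
    ySeq-lower {suc _} _ = if-≤ᵇ-lower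

    xSeq-upper : ∀ {n} → 1 ≤ n → ∀ j → X (suc n) (suc j ℕ.+ 2 ℕ.^ n) ≡ Y n (suc j) + k (suc n)
    xSeq-upper {suc m} _ j = if-≤ᵇ-upper j (2 ℕ.^ suc m) (λ i → Y (suc m) i + k (suc (suc m)))

    ySeq-upper : ∀ {n} → 1 ≤ n → ∀ j → Y (suc n) (suc j ℕ.+ 2 ℕ.^ n) ≡ X n (suc j) + k (suc n)
    ySeq-upper {suc m} _ j = if-≤ᵇ-upper j (2 ℕ.^ suc m) (λ i → X (suc m) i + k (suc (suc m)))

    powerSum-xSeq-halves : ∀ {n} → 1 ≤ n → ∀ t →
      powerSum (X (suc n)) t 1 (2 ℕ.^ suc n)
        ≈ powerSum (X n) t 1 (2 ℕ.^ n) + powerSum (shift (k (suc n)) (Y n)) t 1 (2 ℕ.^ n)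
    powerSum-xSeq-halves {n} 1≤n t =
      trans (sumFrom-halves _ 1 n)
            (+-cong (powerSum-agree-below (xSeq-lower 1≤n) t 1 (2 ℕ.^ n) ℕₚ.≤-refl)
                    (powerSum-translate (2 ℕ.^ n) (xSeq-upper 1≤n) t 0 (2 ℕ.^ n)))

    powerSum-ySeq-halves : ∀ {n} → 1 ≤ n → ∀ t →
      powerSum (Y (suc n)) t 1 (2 ℕ.^ suc n)
        ≈ powerSum (Y n) t 1 (2 ℕ.^ n) + powerSum (shift (k (suc n)) (X n)) t 1 (2 ℕ.^ n)
    powerSum-ySeq-halves {n} 1≤n t =
      trans (sumFrom-halves _ 1 n)
            (+-cong (powerSum-agree-below (ySeq-lower 1≤n) t 1 (2 ℕ.^ n) ℕₚ.≤-refl)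
                    (powerSum-translate (2 ℕ.^ n) (ySeq-upper 1≤n) t 0 (2 ℕ.^ n)))

    module _ (a+b≈c+d : a + b ≈ c + d) where

      equalPowerSums-level : ∀ m → EqualPowerSums (suc m) 1 (2 ℕ.^ suc m) (X (suc m)) (Y (suc m))
      equalPowerSums-level zero = equalPowerSums λ where
        zero          _        → refl
        (suc zero)    _        → begin
          (a + k 1) * 1# + ((b + k 1) * 1# + 0#)  ≈⟨ +-cong (*-identityʳ _) (trans (+-identityʳ _) (*-identityʳ _)) ⟩
          (a + k 1) + (b + k 1)                   ≈⟨ interchange _ _ _ _ ⟩
          (a + b) + (k 1 + k 1)                   ≈⟨ +-congʳ a+b≈c+d ⟩
          (c + d) + (k 1 + k 1)                   ≈⟨ interchange _ _ _ _ ⟩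
          (c + k 1) + (d + k 1)                   ≈⟨ +-cong (*-identityʳ _) (trans (+-identityʳ _) (*-identityʳ _)) ⟨
          (c + k 1) * 1# + ((d + k 1) * 1# + 0#)  ∎
        (suc (suc t)) (s≤s ())
      equalPowerSums-level (suc m) = equalPowerSums λ t t≤2+m → begin
        powerSum (X (suc (suc m))) t 1 (2 ℕ.^ suc (suc m))
          ≈⟨ powerSum-xSeq-halves {suc m} (s≤s z≤n) t ⟩
        powerSum (X (suc m)) t 1 (2 ℕ.^ suc m) + powerSum (shift (k (suc (suc m))) (Y (suc m))) t 1 (2 ℕ.^ suc m)
          ≈⟨ prouhet-doubling (equalPowerSums-level m) (k (suc (suc m))) t t≤2+m ⟩
        powerSum (Y (suc m)) t 1 (2 ℕ.^ suc m) + powerSum (shift (k (suc (suc m))) (X (suc m))) t 1 (2 ℕ.^ suc m)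
          ≈⟨ powerSum-ySeq-halves {suc m} (s≤s z≤n) t ⟨
        powerSum (Y (suc (suc m))) t 1 (2 ℕ.^ suc (suc m))
          ∎

      equalPowerSums-block : ∀ m i p {n} → m ℕ.+ suc i ≡ n → p < 2 ℕ.^ m →
        EqualPowerSums (suc i) (suc (p ℕ.* 2 ℕ.^ suc i)) (2 ℕ.^ suc i) (X n) (Y n)
      equalPowerSums-block zero    i zero    ≡.refl _          = equalPowerSums-level i
      equalPowerSums-block zero    i (suc p) ≡.refl (s≤s ())
      equalPowerSums-block (suc m) i p    ≡.refl p<2ᵐ⁺¹ = [ lower , upper ]′ (<-double-split (2 ℕ.^ m) p<2ᵐ⁺¹)
        where
        n L : ℕ
        n = m ℕ.+ suc i
        L = 2 ℕ.^ suc i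

        k′ : Carrier
        k′ = k (suc n)

        1≤n : 1 ≤ n
        1≤n = ℕₚ.≤-trans (s≤s z≤n) (ℕₚ.m≤n+m (suc i) m)

        lower : p < 2 ℕ.^ m → EqualPowerSums (suc i) (suc (p ℕ.* L)) L (X (suc n)) (Y (suc n))
        lower p<2ᵐ = equalPowerSums λ t t≤1+i → begin
          powerSum (X (suc n)) t (suc (p ℕ.* L)) L  ≈⟨ powerSum-agree-below (xSeq-lower 1≤n) t _ L (lower-block-end-≤ m (suc i) p<2ᵐ) ⟩
          powerSum (X n) t (suc (p ℕ.* L)) L        ≈⟨ powerSum-≈ (equalPowerSums-block m i p ≡.refl p<2ᵐ) t t≤1+i ⟩
          powerSum (Y n) t (suc (p ℕ.* L)) L        ≈⟨ powerSum-agree-below (ySeq-lower 1≤n) t _ L (lower-block-end-≤ m (suc i) p<2ᵐ) ⟨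
          powerSum (Y (suc n)) t (suc (p ℕ.* L)) L  ∎

        upper : ∃[ q ] (q < 2 ℕ.^ m × p ≡ 2 ℕ.^ m ℕ.+ q) →
                EqualPowerSums (suc i) (suc (p ℕ.* L)) L (X (suc n)) (Y (suc n))
        upper (q , q<2ᵐ , ≡.refl) = equalPowerSums λ t t≤1+i → begin
          powerSum (X (suc n)) t (suc ((2 ℕ.^ m ℕ.+ q) ℕ.* L)) L
            ≡⟨ cong (λ s → powerSum (X (suc n)) t s L) (upper-block-start-≡ m (suc i) q) ⟩
          powerSum (X (suc n)) t (suc (q ℕ.* L) ℕ.+ 2 ℕ.^ n) L
            ≈⟨ powerSum-translate (2 ℕ.^ n) (xSeq-upper 1≤n) t (q ℕ.* L) L ⟩
          powerSum (shift k′ (Y n)) t (suc (q ℕ.* L)) L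
            ≈⟨ powerSum-≈ (EqualPowerSums-shift (EqualPowerSums-sym (equalPowerSums-block m i q ≡.refl q<2ᵐ)) k′) t t≤1+i ⟩
          powerSum (shift k′ (X n)) t (suc (q ℕ.* L)) L
            ≈⟨ powerSum-translate (2 ℕ.^ n) (ySeq-upper 1≤n) t (q ℕ.* L) L ⟨
          powerSum (Y (suc n)) t (suc (q ℕ.* L) ℕ.+ 2 ℕ.^ n) L
            ≡⟨ cong (λ s → powerSum (Y (suc n)) t s L) (upper-block-start-≡ m (suc i) q) ⟨
          powerSum (Y (suc n)) t (suc ((2 ℕ.^ m ℕ.+ q) ℕ.* L)) L
            ∎

mainTheorem4 : {ℓ₁ ℓ₂ : Level} (R : CommutativeRing ℓ₁ ℓ₂) →
    let open CommutativeRing R in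
    (a b c d : Carrier) → a + b ≈ c + d →
    (n : ℕ) → 1 ≤ n → (k : ℕ → Carrier) →
    (i p : ℕ) → 1 ≤ i → i ≤ n → p ≤ (2 ℕ.^ (n ∸ i)) ∸ 1 →
    sumFrom R (λ j → pow R (xSeq R a b c d k n j) i) (suc (p ℕ.* 2 ℕ.^ i)) (2 ℕ.^ i)
      ≈ sumFrom R (λ j → pow R (ySeq R a b c d k n j) i) (suc (p ℕ.* 2 ℕ.^ i)) (2 ℕ.^ i)
mainTheorem4 R a b c d a+b≈c+d n _ k (suc i) p _ i≤n p≤2ᵐ∸1 =
  EqualPowerSums.powerSum-≈
    (equalPowerSums-block R a b c d k a+b≈c+d (n ∸ suc i) i p (ℕₚ.m∸n+n≡m i≤n) p<2ᵐ)
    (suc i) ℕₚ.≤-refl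
  where
  p<2ᵐ : p < 2 ℕ.^ (n ∸ suc i)
  p<2ᵐ = ≤∸1⇒< (ℕₚ.m^n>0 2 (n ∸ suc i)) p≤2ᵐ∸1
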